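{- Let $k=2K+1\ge5$ be an odd integer. For every integer $s$ with $1\le s\le K$ and every integer $i$, $$-\sum_{n=0}^{k-2s}\binom{i}{k-2s-n}\binom{n+2s-2}{n}B_n=\sum_{n=0}^{k-2s}\binom{k-2-i}{k-2s-n}\binom{n+2s-2}{n}B_n.$$
   Context: $B_n$ is the $n$th Bernoulli number, defined by $\frac{t}{e^t-1}=\sum_{n\ge0}B_n\frac{t^n}{n!}$ (so $B_1=-\tfrac12$). For an integer $a$ (possibly negative) and an integer $m\ge0$, $\binom{a}{m}=\frac{a(a-1)\cdots(a-m+1)}{m!}$; in particular for negative $a$, $\binom{a}{m}=(-1)^m\binom{ -a+m-1}{m}$, and for $a\ge0$ this is the usual binomial coefficient (zero when $m>a$). -}

module Defs where

open import Data.Nat as ℕ using (ℕ; zero; suc; _∸_)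
open import Data.Nat.Combinatorics using (_C_)
open import Data.Integer as ℤ using (ℤ; +_; -[1+_])
open import Data.Rational as ℚ using (ℚ; 0ℚ; 1ℚ; _+_; _*_; -_; _/_)
open import Data.List using (List; []; _∷_; reverse; length)

sumℚ : ℕ → (ℕ → ℚ) → ℚ
sumℚ zero    f = 0ℚ
sumℚ (suc n) f = sumℚ n f + f n

ℤtoℚ : ℤ → ℚ
ℤtoℚ z = z / 1

-- Generalized binomial coefficient binom a m for integer a, natural m:
--   a ≥ 0:       the usual binomial coefficient (0 when m > a)
--   a = -(n+1):  (-1)^m * binom (n + m) m  ( = (-1)^m binom(-a+m-1, m) )
sign : ℕ → ℤ
sign zero    = + 1
sign (suc m) = ℤ.- sign m

binom : ℤ → ℕ → ℤ
binom (+ n)    m = + (n C m)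
binom -[1+ n ] m = sign m ℤ.* (+ ((n ℕ.+ m) C m))

-- Bernoulli numbers with B₁ = -1/2, via t/(e^t - 1) = Σ Bₙ tⁿ/n!,
-- equivalently B₀ = 1 and Σ_{j=0}^{m} C(m+1,j) B_j = 0 for m ≥ 1, i.e.
--   B_m = -(1/(m+1)) Σ_{j<m} C(m+1,j) B_j.
-- bernList m = [B_m, B_{m-1}, ..., B_0]
lookupRev : List ℚ → ℕ → ℚ
lookupRev xs j = go (reverse xs) j
  where
  go : List ℚ → ℕ → ℚ
  go []       _       = 0ℚ
  go (x ∷ _)  zero    = x
  go (_ ∷ xs) (suc j) = go xs j

bernList : ℕ → List ℚ
bernList zero    = 1ℚ ∷ []
bernList (suc m) = next ∷ prev
  where
  prev : List ℚ
  prev = bernList m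
  next : ℚ
  next = - ((+ 1 / suc (suc m)) *
             sumℚ (suc m) (λ j → ℤtoℚ (+ ((suc (suc m)) C j)) * lookupRev prev j))

B : ℕ → ℚ
B zero    = 1ℚ
B (suc m) = lookupRev (bernList (suc m)) (suc m)

-- Put Q_m(x) = Σ_{n ≤ m} binom(x, m - n) binom(n + r, n) B_n, so that with m = k - 2s (odd) and
-- r = 2s - 2 the theorem says -Q_m(i) = Q_m(m + r - i).  We prove Q_m(x) = (-1)^m Q_m(m + r - x)
-- for every m, r and x by induction on m.  Pascal's rule gives Q_{m+1}(x+1) = Q_{m+1}(x) + Q_m(x),
-- so by the induction hypothesis the defect Q_{m+1}(x) - (-1)^{m+1} Q_{m+1}(N - x), N = m + 1 + r,
-- is invariant under x ↦ x + 1, hence constant.  Its sum over x = 0, …, N, which is N + 1 times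
-- the defect, equals T - (-1)^{m+1} T with T = Σ_{x ≤ N} Q_{m+1}(x) = Q_{m+2}(N + 1) - Q_{m+2}(0)
-- by telescoping.  And T = 0: the trinomial revision C(M+r, M-n) C(n+r, n) = C(M+r, r) C(M, n)
-- turns Q_M(M + r) into C(M+r, r) Σ_n C(M, n) B_n, which the Bernoulli recurrence reduces to
-- C(M+r, r) B_M = Q_M(0) for M ≥ 2.  So the defect is 0.

module Submission where

open import Defs
open import Data.Nat as ℕ using (ℕ; zero; suc; _≤_; _<_; _∸_; z≤n; s≤s; _!)
import Data.Nat.Properties as ℕP
open import Data.Nat.Combinatorics using (_C_; nCn≡1; nC1≡n; nCk≡nC[n∸k]; nCk+nC[k+1]≡[n+1]C[k+1]; nCk≡n!/k![n-k]!; k![n∸k]!∣n!)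
open import Data.Nat.DivMod using (m/n*n≡m)
open import Data.Integer as ℤ using (ℤ; +_; -[1+_])
import Data.Integer.Properties as ℤP
import Data.Integer.Tactic.RingSolver as ℤ-Solver
import Data.Nat.Tactic.RingSolver as ℕ-Solver
open import Data.List using (List; []; _∷_; _++_; _∷ʳ_; reverse; length)
open import Data.List.Properties using (reverse-involutive; unfold-reverse; length-reverse)
open import Data.Sum using (inj₁; inj₂)
open import Data.Rational as ℚ using (ℚ; 0ℚ; 1ℚ; -_; _+_; _-_; _*_; _/_; toℚᵘ; fromℚᵘ)
import Data.Rational.Properties as ℚP
import Data.Rational.Unnormalised as ℚᵘ
import Data.Rational.Unnormalised.Properties as ℚᵘP
open import Level using (0ℓ)
open import Relation.Nullary.Decidable using (dec⇒maybe)
open import Relation.Binary.PropositionalEquality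
open import Tactic.RingSolver using (solve-∀)
open import Tactic.RingSolver.Core.AlmostCommutativeRing using (AlmostCommutativeRing; fromCommutativeRing)

ℚ-ring : AlmostCommutativeRing 0ℓ 0ℓ
ℚ-ring = fromCommutativeRing ℚP.+-*-commutativeRing (λ x → dec⇒maybe (0ℚ ℚ.≟ x))

fromℚᵘ-homo-+ : ∀ p q → fromℚᵘ (p ℚᵘ.+ q) ≡ fromℚᵘ p + fromℚᵘ q
fromℚᵘ-homo-+ p q = begin
  fromℚᵘ (p ℚᵘ.+ q)                                  ≡⟨ ℚP.fromℚᵘ-cong (ℚᵘP.+-cong (ℚP.toℚᵘ-fromℚᵘ p) (ℚP.toℚᵘ-fromℚᵘ q)) ⟨
  fromℚᵘ (toℚᵘ (fromℚᵘ p) ℚᵘ.+ toℚᵘ (fromℚᵘ q))      ≡⟨ ℚP.fromℚᵘ-cong (ℚP.toℚᵘ-homo-+ (fromℚᵘ p) (fromℚᵘ q)) ⟨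
  fromℚᵘ (toℚᵘ (fromℚᵘ p + fromℚᵘ q))                ≡⟨ ℚP.fromℚᵘ-toℚᵘ _ ⟩
  fromℚᵘ p + fromℚᵘ q                                ∎
  where open ≡-Reasoning

fromℚᵘ-homo-* : ∀ p q → fromℚᵘ (p ℚᵘ.* q) ≡ fromℚᵘ p * fromℚᵘ q
fromℚᵘ-homo-* p q = begin
  fromℚᵘ (p ℚᵘ.* q)                                  ≡⟨ ℚP.fromℚᵘ-cong (ℚᵘP.*-cong (ℚP.toℚᵘ-fromℚᵘ p) (ℚP.toℚᵘ-fromℚᵘ q)) ⟨
  fromℚᵘ (toℚᵘ (fromℚᵘ p) ℚᵘ.* toℚᵘ (fromℚᵘ q))      ≡⟨ ℚP.fromℚᵘ-cong (ℚP.toℚᵘ-homo-* (fromℚᵘ p) (fromℚᵘ q)) ⟨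
  fromℚᵘ (toℚᵘ (fromℚᵘ p * fromℚᵘ q))                ≡⟨ ℚP.fromℚᵘ-toℚᵘ _ ⟩
  fromℚᵘ p * fromℚᵘ q                                ∎
  where open ≡-Reasoning

ℤtoℚ-homo-+ : ∀ a b → ℤtoℚ (a ℤ.+ b) ≡ ℤtoℚ a + ℤtoℚ b
ℤtoℚ-homo-+ a b = trans
  (ℚP.fromℚᵘ-cong {ℚᵘ.mkℚᵘ (a ℤ.+ b) 0} {ℚᵘ.mkℚᵘ a 0 ℚᵘ.+ ℚᵘ.mkℚᵘ b 0} (ℚᵘ.*≡* (cross-multiplied a b)))
  (fromℚᵘ-homo-+ (ℚᵘ.mkℚᵘ a 0) (ℚᵘ.mkℚᵘ b 0))
  where
  cross-multiplied : ∀ a b → (a ℤ.+ b) ℤ.* + 1 ≡ (a ℤ.* + 1 ℤ.+ b ℤ.* + 1) ℤ.* + 1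
  cross-multiplied = ℤ-Solver.solve-∀

ℤtoℚ-homo-* : ∀ a b → ℤtoℚ (a ℤ.* b) ≡ ℤtoℚ a * ℤtoℚ b
ℤtoℚ-homo-* a b = fromℚᵘ-homo-* (ℚᵘ.mkℚᵘ a 0) (ℚᵘ.mkℚᵘ b 0)

ℤtoℚ[1+n]*1/[1+n]≡1 : ∀ n → ℤtoℚ (+ suc n) * (+ 1 / suc n) ≡ 1ℚ
ℤtoℚ[1+n]*1/[1+n]≡1 n = trans
  (sym (fromℚᵘ-homo-* (ℚᵘ.mkℚᵘ (+ suc n) 0) (ℚᵘ.mkℚᵘ (+ 1) n)))
  (ℚP.fromℚᵘ-cong {ℚᵘ.mkℚᵘ (+ suc n) 0 ℚᵘ.* ℚᵘ.mkℚᵘ (+ 1) n} {ℚᵘ.1ℚᵘ}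
    (ℚᵘ.*≡* (cong (λ d → + suc d) (ℕ-Solver.solve (n ∷ [])))))

ℤtoℚ[1+n]*p≡0⇒p≡0 : ∀ n p → ℤtoℚ (+ suc n) * p ≡ 0ℚ → p ≡ 0ℚ
ℤtoℚ[1+n]*p≡0⇒p≡0 n p [1+n]*p≡0 = begin
  p                       ≡⟨ ℚP.*-identityˡ p ⟨
  1ℚ * p                  ≡⟨ cong (_* p) (ℤtoℚ[1+n]*1/[1+n]≡1 n) ⟨
  [1+n] * 1/[1+n] * p     ≡⟨ rotate [1+n] 1/[1+n] p ⟩
  1/[1+n] * ([1+n] * p)   ≡⟨ cong (1/[1+n] *_) [1+n]*p≡0 ⟩
  1/[1+n] * 0ℚ            ≡⟨ ℚP.*-zeroʳ 1/[1+n] ⟩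
  0ℚ                      ∎
  where
  open ≡-Reasoning
  [1+n] = ℤtoℚ (+ suc n)
  1/[1+n] = + 1 / suc n
  rotate : ∀ a b c → a * b * c ≡ b * (a * c)
  rotate = solve-∀ ℚ-ring

sumℚ-cong : ∀ n {f g : ℕ → ℚ} → (∀ j → j < n → f j ≡ g j) → sumℚ n f ≡ sumℚ n g
sumℚ-cong zero    f≗g = refl
sumℚ-cong (suc n) f≗g = cong₂ _+_ (sumℚ-cong n (λ j j<n → f≗g j (ℕP.m<n⇒m<1+n j<n))) (f≗g n ℕP.≤-refl)

sumℚ-zero : ∀ n {f : ℕ → ℚ} → (∀ j → j < n → f j ≡ 0ℚ) → sumℚ n f ≡ 0ℚ
sumℚ-zero zero    f≡0 = refl
sumℚ-zero (suc n) f≡0 = cong₂ _+_ (sumℚ-zero n (λ j j<n → f≡0 j (ℕP.m<n⇒m<1+n j<n))) (f≡0 n ℕP.≤-refl)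

sumℚ-distrib-+ : ∀ n (f g : ℕ → ℚ) → sumℚ n (λ j → f j + g j) ≡ sumℚ n f + sumℚ n g
sumℚ-distrib-+ zero    f g = refl
sumℚ-distrib-+ (suc n) f g = begin
  sumℚ n (λ j → f j + g j) + (f n + g n)  ≡⟨ cong (_+ (f n + g n)) (sumℚ-distrib-+ n f g) ⟩
  sumℚ n f + sumℚ n g + (f n + g n)       ≡⟨ interchange (sumℚ n f) (sumℚ n g) (f n) (g n) ⟩
  sumℚ n f + f n + (sumℚ n g + g n)       ∎
  where
  open ≡-Reasoning
  interchange : ∀ a b c d → a + b + (c + d) ≡ a + c + (b + d)
  interchange = solve-∀ ℚ-ring

*-distribˡ-sumℚ : ∀ n c (f : ℕ → ℚ) → sumℚ n (λ j → c * f j) ≡ c * sumℚ n f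
*-distribˡ-sumℚ zero    c f = sym (ℚP.*-zeroʳ c)
*-distribˡ-sumℚ (suc n) c f = begin
  sumℚ n (λ j → c * f j) + c * f n  ≡⟨ cong (_+ c * f n) (*-distribˡ-sumℚ n c f) ⟩
  c * sumℚ n f + c * f n            ≡⟨ ℚP.*-distribˡ-+ c (sumℚ n f) (f n) ⟨
  c * (sumℚ n f + f n)              ∎
  where open ≡-Reasoning

sumℚ-sub-* : ∀ n c (f g : ℕ → ℚ) → sumℚ n (λ j → f j - c * g j) ≡ sumℚ n f - c * sumℚ n g
sumℚ-sub-* zero    c f g = 0≡0-c*0 c
  where
  0≡0-c*0 : ∀ c → 0ℚ ≡ 0ℚ - c * 0ℚ
  0≡0-c*0 = solve-∀ ℚ-ring
sumℚ-sub-* (suc n) c f g = begin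
  sumℚ n (λ j → f j - c * g j) + (f n - c * g n)  ≡⟨ cong (_+ (f n - c * g n)) (sumℚ-sub-* n c f g) ⟩
  sumℚ n f - c * sumℚ n g + (f n - c * g n)       ≡⟨ regroup (sumℚ n f) (sumℚ n g) (f n) (g n) c ⟩
  sumℚ n f + f n - c * (sumℚ n g + g n)           ∎
  where
  open ≡-Reasoning
  regroup : ∀ a b x y c → a - c * b + (x - c * y) ≡ a + x - c * (b + y)
  regroup = solve-∀ ℚ-ring

sumℚ-const : ∀ n c → sumℚ n (λ _ → c) ≡ ℤtoℚ (+ n) * c
sumℚ-const zero    c = sym (ℚP.*-zeroˡ c)
sumℚ-const (suc n) c = begin
  sumℚ n (λ _ → c) + c              ≡⟨ cong (_+ c) (sumℚ-const n c) ⟩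
  ℤtoℚ (+ n) * c + c                ≡⟨ distrib (ℤtoℚ (+ n)) c ⟩
  (1ℚ + ℤtoℚ (+ n)) * c             ≡⟨ cong (_* c) (ℤtoℚ-homo-+ (+ 1) (+ n)) ⟨
  ℤtoℚ (+ suc n) * c                ∎
  where
  open ≡-Reasoning
  distrib : ∀ a c → a * c + c ≡ (1ℚ + a) * c
  distrib = solve-∀ ℚ-ring

sumℚ-peelˡ : ∀ n (f : ℕ → ℚ) → sumℚ (suc n) f ≡ f 0 + sumℚ n (λ j → f (suc j))
sumℚ-peelˡ zero    f = trans (ℚP.+-identityˡ (f 0)) (sym (ℚP.+-identityʳ (f 0)))
sumℚ-peelˡ (suc n) f = begin
  sumℚ (suc n) f + f (suc n)                        ≡⟨ cong (_+ f (suc n)) (sumℚ-peelˡ n f) ⟩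
  f 0 + sumℚ n (λ j → f (suc j)) + f (suc n)        ≡⟨ ℚP.+-assoc (f 0) _ (f (suc n)) ⟩
  f 0 + (sumℚ n (λ j → f (suc j)) + f (suc n))      ∎
  where open ≡-Reasoning

sumℚ-reverse : ∀ n (f : ℕ → ℚ) → sumℚ (suc n) (λ j → f (n ∸ j)) ≡ sumℚ (suc n) f
sumℚ-reverse zero    f = refl
sumℚ-reverse (suc n) f = begin
  sumℚ (suc (suc n)) (λ j → f (suc n ∸ j))   ≡⟨ sumℚ-peelˡ (suc n) (λ j → f (suc n ∸ j)) ⟩
  f (suc n) + sumℚ (suc n) (λ j → f (n ∸ j)) ≡⟨ cong (λ s → f (suc n) + s) (sumℚ-reverse n f) ⟩
  f (suc n) + sumℚ (suc n) f                 ≡⟨ ℚP.+-comm (f (suc n)) _ ⟩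
  sumℚ (suc (suc n)) f                       ∎
  where open ≡-Reasoning

sumℚ-telescope : ∀ n (F f : ℕ → ℚ) → (∀ j → F (suc j) ≡ F j + f j) → sumℚ n f ≡ F n - F 0
sumℚ-telescope zero    F f ΔF = sym (ℚP.+-inverseʳ (F 0))
sumℚ-telescope (suc n) F f ΔF = begin
  sumℚ n f + f n       ≡⟨ cong (_+ f n) (sumℚ-telescope n F f ΔF) ⟩
  F n - F 0 + f n      ≡⟨ swap (F n) (F 0) (f n) ⟩
  F n + f n - F 0      ≡⟨ cong (_- F 0) (ΔF n) ⟨
  F (suc n) - F 0      ∎
  where
  open ≡-Reasoning
  swap : ∀ a b c → a - b + c ≡ a + c - b
  swap = solve-∀ ℚ-ring

-- Binomial coefficients

binom[i,0]≡1 : ∀ i → binom i 0 ≡ + 1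
binom[i,0]≡1 (+ n)    = refl
binom[i,0]≡1 -[1+ n ] = refl

binom-pascal : ∀ i j → binom (ℤ.suc i) (suc j) ≡ binom i (suc j) ℤ.+ binom i j
binom-pascal (+ n) j =
  cong +_ (trans (sym (nCk+nC[k+1]≡[n+1]C[k+1] n j)) (ℕP.+-comm (n C j) (n C suc j)))
binom-pascal -[1+ zero ] j rewrite nCn≡1 (suc j) | nCn≡1 j = cancel (sign j)
  where
  cancel : ∀ s → + 0 ≡ ℤ.- s ℤ.* + 1 ℤ.+ s ℤ.* + 1
  cancel = ℤ-Solver.solve-∀
binom-pascal -[1+ suc n ] j
  rewrite ℕP.+-suc n j | sym (nCk+nC[k+1]≡[n+1]C[k+1] (suc (n ℕ.+ j)) j) =
  regroup (sign j) (+ (suc (n ℕ.+ j) C suc j)) (+ (suc (n ℕ.+ j) C j))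
  where
  regroup : ∀ s a b → ℤ.- s ℤ.* a ≡ ℤ.- s ℤ.* (b ℤ.+ a) ℤ.+ s ℤ.* b
  regroup = ℤ-Solver.solve-∀

nCk*[k!*l!]≡n! : ∀ {n} k l → k ℕ.+ l ≡ n → (n C k) ℕ.* (k ! ℕ.* l !) ≡ n !
nCk*[k!*l!]≡n! k l refl = begin
  ((k ℕ.+ l) C k) ℕ.* (k ! ℕ.* l !)              ≡⟨ cong (λ m → ((k ℕ.+ l) C k) ℕ.* (k ! ℕ.* m !)) (ℕP.m+n∸m≡n k l) ⟨
  ((k ℕ.+ l) C k) ℕ.* (k ! ℕ.* (k ℕ.+ l ∸ k) !)  ≡⟨ cong (ℕ._* (k ! ℕ.* (k ℕ.+ l ∸ k) !)) (nCk≡n!/k![n-k]! k≤k+l) ⟩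
  ((k ℕ.+ l) ! ℕ./ (k ! ℕ.* (k ℕ.+ l ∸ k) !)) ℕ.* (k ! ℕ.* (k ℕ.+ l ∸ k) !)
                                               ≡⟨ m/n*n≡m (k![n∸k]!∣n! k≤k+l) ⟩
  (k ℕ.+ l) !                                  ∎
  where
  open ≡-Reasoning
  k≤k+l = ℕP.m≤m+n k l
  instance _ = ℕP._!*_!≢0 k (k ℕ.+ l ∸ k)

trinomial-revision : ∀ a n r →
  ((a ℕ.+ n ℕ.+ r) C a) ℕ.* ((n ℕ.+ r) C n) ≡ ((a ℕ.+ n ℕ.+ r) C r) ℕ.* ((a ℕ.+ n) C n)
trinomial-revision a n r = ℕP.*-cancelʳ-≡ _ _ (a ! ℕ.* n ! ℕ.* r !) (begin
  (N C a) ℕ.* ((n ℕ.+ r) C n) ℕ.* (a ! ℕ.* n ! ℕ.* r !)    ≡⟨ regroupˡ (N C a) ((n ℕ.+ r) C n) (a !) (n !) (r !) ⟩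
  (N C a) ℕ.* (a ! ℕ.* (((n ℕ.+ r) C n) ℕ.* (n ! ℕ.* r !)))  ≡⟨ cong (λ x → (N C a) ℕ.* (a ! ℕ.* x)) (nCk*[k!*l!]≡n! n r refl) ⟩
  (N C a) ℕ.* (a ! ℕ.* (n ℕ.+ r) !)                       ≡⟨ nCk*[k!*l!]≡n! a (n ℕ.+ r) (sym (ℕP.+-assoc a n r)) ⟩
  N !                                                   ≡⟨ nCk*[k!*l!]≡n! r (a ℕ.+ n) (ℕP.+-comm r (a ℕ.+ n)) ⟨
  (N C r) ℕ.* (r ! ℕ.* (a ℕ.+ n) !)                       ≡⟨ cong (λ x → (N C r) ℕ.* (r ! ℕ.* x)) (nCk*[k!*l!]≡n! n a (ℕP.+-comm n a)) ⟨
  (N C r) ℕ.* (r ! ℕ.* (((a ℕ.+ n) C n) ℕ.* (n ! ℕ.* a !)))  ≡⟨ regroupʳ (N C r) ((a ℕ.+ n) C n) (a !) (n !) (r !) ⟩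
  (N C r) ℕ.* ((a ℕ.+ n) C n) ℕ.* (a ! ℕ.* n ! ℕ.* r !)    ∎)
  where
  open ≡-Reasoning
  N = a ℕ.+ n ℕ.+ r
  instance _ = ℕP.m*n≢0 (a ! ℕ.* n !) (r !) {{ℕP._!*_!≢0 a n}} {{ℕP._!≢0 r}}
  regroupˡ : ∀ x y u v w → x ℕ.* y ℕ.* (u ℕ.* v ℕ.* w) ≡ x ℕ.* (u ℕ.* (y ℕ.* (v ℕ.* w)))
  regroupˡ = ℕ-Solver.solve-∀
  regroupʳ : ∀ x y u v w → x ℕ.* (w ℕ.* (y ℕ.* (v ℕ.* u))) ≡ x ℕ.* y ℕ.* (u ℕ.* v ℕ.* w)
  regroupʳ = ℕ-Solver.solve-∀

-- Bernoulli numbers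

-- The local helper `go` of lookupRev, which is not in scope here.
index : List ℚ → ℕ → ℚ
index []       _       = 0ℚ
index (x ∷ _)  zero    = x
index (_ ∷ xs) (suc j) = index xs j

lookupRev≡index∘reverse : ∀ xs j → lookupRev xs j ≡ index (reverse xs) j
lookupRev≡index∘reverse xs j with reverse xs
... | []     = refl
... | y ∷ ys with j
...   | zero  = refl
...   | suc j rewrite sym (reverse-involutive ys) = lookupRev≡index∘reverse (reverse ys) j

index-++ˡ : ∀ ys zs {j} → j < length ys → index (ys ++ zs) j ≡ index ys j
index-++ˡ (y ∷ ys) zs {zero}  _         = refl
index-++ˡ (y ∷ ys) zs {suc j} (s≤s j<) = index-++ˡ ys zs j<

index-∷ʳ-length : ∀ ys x → index (ys ∷ʳ x) (length ys) ≡ x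
index-∷ʳ-length []       x = refl
index-∷ʳ-length (y ∷ ys) x = index-∷ʳ-length ys x

lookupRev-∷-< : ∀ x xs {j} → j < length xs → lookupRev (x ∷ xs) j ≡ lookupRev xs j
lookupRev-∷-< x xs {j} j<len = begin
  lookupRev (x ∷ xs) j              ≡⟨ lookupRev≡index∘reverse (x ∷ xs) j ⟩
  index (reverse (x ∷ xs)) j        ≡⟨ cong (λ ys → index ys j) (unfold-reverse x xs) ⟩
  index (reverse xs ∷ʳ x) j         ≡⟨ index-++ˡ (reverse xs) (x ∷ []) (subst (j <_) (sym (length-reverse xs)) j<len) ⟩
  index (reverse xs) j              ≡⟨ lookupRev≡index∘reverse xs j ⟨
  lookupRev xs j                    ∎
  where open ≡-Reasoning

lookupRev-∷-length : ∀ x xs → lookupRev (x ∷ xs) (length xs) ≡ x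
lookupRev-∷-length x xs = begin
  lookupRev (x ∷ xs) (length xs)                  ≡⟨ lookupRev≡index∘reverse (x ∷ xs) (length xs) ⟩
  index (reverse (x ∷ xs)) (length xs)            ≡⟨ cong₂ index (unfold-reverse x xs) (sym (length-reverse xs)) ⟩
  index (reverse xs ∷ʳ x) (length (reverse xs))   ≡⟨ index-∷ʳ-length (reverse xs) x ⟩
  x                                               ∎
  where open ≡-Reasoning

length-bernList : ∀ m → length (bernList m) ≡ suc m
length-bernList zero    = refl
length-bernList (suc m) = cong suc (length-bernList m)

lookupRev-bernList : ∀ {m j} → j ≤ m → lookupRev (bernList m) j ≡ B j
lookupRev-bernList {zero}  z≤n = refl
lookupRev-bernList {suc m} {j} j≤1+m with ℕP.m≤n⇒m<n∨m≡n j≤1+m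
... | inj₂ refl       = refl
... | inj₁ (s≤s j≤m) = trans (lookupRev-∷-< _ (bernList m) j<len) (lookupRev-bernList j≤m)
  where j<len = subst (j <_) (sym (length-bernList m)) (s≤s j≤m)

B-suc : ∀ m → B (suc m) ≡
  - ((+ 1 / suc (suc m)) * sumℚ (suc m) (λ j → ℤtoℚ (+ (suc (suc m) C j)) * B j))
B-suc m = begin
  B (suc m)                                          ≡⟨ cong (lookupRev (bernList (suc m))) (length-bernList m) ⟨
  lookupRev (bernList (suc m)) (length (bernList m)) ≡⟨ lookupRev-∷-length _ (bernList m) ⟩
  _                                                  ≡⟨ cong (λ S → - ((+ 1 / suc (suc m)) * S)) (sumℚ-cong (suc m) coefficient) ⟩
  _                                                  ∎
  where
  open ≡-Reasoning
  coefficient : ∀ j → j < suc m → ℤtoℚ (+ (suc (suc m) C j)) * lookupRev (bernList m) j ≡ ℤtoℚ (+ (suc (suc m) C j)) * B j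
  coefficient j (s≤s j≤m) = cong (ℤtoℚ (+ (suc (suc m) C j)) *_) (lookupRev-bernList j≤m)

BernoulliRecurrence : (ℕ → ℚ) → Set
BernoulliRecurrence β = ∀ m → sumℚ (suc (suc m)) (λ j → ℤtoℚ (+ (suc (suc m) C j)) * β j) ≡ 0ℚ

B-recurrence : BernoulliRecurrence B
B-recurrence m = begin
  S + ℤtoℚ (+ (suc (suc m) C suc m)) * B (suc m)  ≡⟨ cong₂ (λ c b → S + ℤtoℚ (+ c) * b) [m+2]C[m+1]≡m+2 (B-suc m) ⟩
  S + c * - (1/c * S)                            ≡⟨ cancel S c 1/c ⟩
  S - c * 1/c * S                                ≡⟨ cong (λ x → S - x * S) (ℤtoℚ[1+n]*1/[1+n]≡1 (suc m)) ⟩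
  S - 1ℚ * S                                     ≡⟨ S-1*S≡0 S ⟩
  0ℚ                                             ∎
  where
  open ≡-Reasoning
  S = sumℚ (suc m) (λ j → ℤtoℚ (+ (suc (suc m) C j)) * B j)
  c = ℤtoℚ (+ suc (suc m))
  1/c = + 1 / suc (suc m)
  [m+2]C[m+1]≡m+2 : suc (suc m) C suc m ≡ suc (suc m)
  [m+2]C[m+1]≡m+2 = trans (nCk≡nC[n∸k] (ℕP.n≤1+n (suc m))) (trans (cong (suc (suc m) C_) (ℕP.m+n∸n≡m 1 m)) (nC1≡n (suc (suc m))))
  cancel : ∀ S c d → S + c * - (d * S) ≡ S - c * d * S
  cancel = solve-∀ ℚ-ring
  S-1*S≡0 : ∀ S → S - 1ℚ * S ≡ 0ℚ
  S-1*S≡0 = solve-∀ ℚ-ring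

-- Reflection symmetry of the sums Q_m(x)

suc-invariant⇒constant : ∀ {a} {A : Set a} (f : ℤ → A) → (∀ x → f (ℤ.suc x) ≡ f x) → ∀ x → f x ≡ f (+ 0)
suc-invariant⇒constant f f-suc (+ zero)      = refl
suc-invariant⇒constant f f-suc (+ suc n)     = trans (f-suc (+ n)) (suc-invariant⇒constant f f-suc (+ n))
suc-invariant⇒constant f f-suc -[1+ zero ]   = sym (f-suc -[1+ zero ])
suc-invariant⇒constant f f-suc -[1+ suc n ]  = trans (sym (f-suc -[1+ suc n ])) (suc-invariant⇒constant f f-suc -[1+ n ])

signℚ : ℕ → ℚ
signℚ zero    = 1ℚ
signℚ (suc m) = - signℚ m

[+m]-[+n]≡+[m∸n] : ∀ {m n} → n ≤ m → + m ℤ.- + n ≡ + (m ∸ n)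
[+m]-[+n]≡+[m∸n] {m} {n} n≤m = trans (ℤP.[+m]-[+n]≡m⊖n m n) (ℤP.⊖-≥ n≤m)

signℚ-even : ∀ t → signℚ (t ℕ.+ t) ≡ 1ℚ
signℚ-even zero    = refl
signℚ-even (suc t) = trans (cong (λ u → - signℚ u) (ℕP.+-suc t t)) (cong (λ q → - - q) (signℚ-even t))

-- binomSum β m r x = Q_m(x), with an arbitrary sequence β in place of B.
binomSum : (ℕ → ℚ) → ℕ → ℕ → ℤ → ℚ
binomSum β m r x = sumℚ (suc m) (λ n → ℤtoℚ (binom x (m ∸ n)) * ℤtoℚ (binom (+ (n ℕ.+ r)) n) * β n)

binomSum-pascal : ∀ β m r x → binomSum β (suc m) r (ℤ.suc x) ≡ binomSum β (suc m) r x + binomSum β m r x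
binomSum-pascal β m r x = begin
  sumℚ (suc m) (F (ℤ.suc x)) + F (ℤ.suc x) (suc m)
    ≡⟨ cong₂ _+_ (trans (sumℚ-cong (suc m) pascal-term) (sumℚ-distrib-+ (suc m) (F x) G)) last-term ⟩
  sumℚ (suc m) (F x) + binomSum β m r x + F x (suc m)
    ≡⟨ swap (sumℚ (suc m) (F x)) (binomSum β m r x) (F x (suc m)) ⟩
  sumℚ (suc m) (F x) + F x (suc m) + binomSum β m r x ∎
  where
  open ≡-Reasoning
  b : ℕ → ℚ
  b n = ℤtoℚ (binom (+ (n ℕ.+ r)) n)
  F : ℤ → ℕ → ℚ
  F y n = ℤtoℚ (binom y (suc m ∸ n)) * b n * β n
  G : ℕ → ℚ
  G n = ℤtoℚ (binom x (m ∸ n)) * b n * β n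
  distrib : ∀ p q c d → (p + q) * c * d ≡ p * c * d + q * c * d
  distrib = solve-∀ ℚ-ring
  swap : ∀ p q c → p + q + c ≡ p + c + q
  swap = solve-∀ ℚ-ring
  pascal-term : ∀ n → n < suc m → F (ℤ.suc x) n ≡ F x n + G n
  pascal-term n (s≤s n≤m) = begin
    ℤtoℚ (binom (ℤ.suc x) (suc m ∸ n)) * b n * β n
      ≡⟨ cong (λ j → ℤtoℚ (binom (ℤ.suc x) j) * b n * β n) 1+m∸n≡1+[m∸n] ⟩
    ℤtoℚ (binom (ℤ.suc x) (suc (m ∸ n))) * b n * β n
      ≡⟨ cong (λ z → ℤtoℚ z * b n * β n) (binom-pascal x (m ∸ n)) ⟩
    ℤtoℚ (binom x (suc (m ∸ n)) ℤ.+ binom x (m ∸ n)) * b n * β n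
      ≡⟨ cong (λ q → q * b n * β n) (ℤtoℚ-homo-+ (binom x (suc (m ∸ n))) (binom x (m ∸ n))) ⟩
    (ℤtoℚ (binom x (suc (m ∸ n))) + ℤtoℚ (binom x (m ∸ n))) * b n * β n
      ≡⟨ distrib (ℤtoℚ (binom x (suc (m ∸ n)))) (ℤtoℚ (binom x (m ∸ n))) (b n) (β n) ⟩
    ℤtoℚ (binom x (suc (m ∸ n))) * b n * β n + G n
      ≡⟨ cong (λ j → ℤtoℚ (binom x j) * b n * β n + G n) 1+m∸n≡1+[m∸n] ⟨
    F x n + G n ∎
    where 1+m∸n≡1+[m∸n] = ℕP.+-∸-assoc 1 n≤m
  last-term : F (ℤ.suc x) (suc m) ≡ F x (suc m)
  last-term = cong (λ z → ℤtoℚ z * b (suc m) * β (suc m)) (begin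
    binom (ℤ.suc x) (m ∸ m)  ≡⟨ cong (binom (ℤ.suc x)) (ℕP.n∸n≡0 m) ⟩
    binom (ℤ.suc x) 0        ≡⟨ binom[i,0]≡1 (ℤ.suc x) ⟩
    + 1                      ≡⟨ binom[i,0]≡1 x ⟨
    binom x 0                ≡⟨ cong (binom x) (ℕP.n∸n≡0 m) ⟨
    binom x (m ∸ m)          ∎)

binomSum[0]-constant : ∀ β r x y → binomSum β 0 r x ≡ binomSum β 0 r y
binomSum[0]-constant β r x y =
  cong (λ z → 0ℚ + ℤtoℚ z * ℤtoℚ (binom (+ r) 0) * β 0) (trans (binom[i,0]≡1 x) (sym (binom[i,0]≡1 y)))

binomSum-at-0 : ∀ β M r → binomSum β M r (+ 0) ≡ ℤtoℚ (+ ((M ℕ.+ r) C r)) * β M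
binomSum-at-0 β M r = begin
  sumℚ M f + f M
    ≡⟨ cong (_+ f M) (sumℚ-zero M vanishing) ⟩
  0ℚ + f M
    ≡⟨ ℚP.+-identityˡ (f M) ⟩
  ℤtoℚ (binom (+ 0) (M ∸ M)) * ℤtoℚ (+ ((M ℕ.+ r) C M)) * β M
    ≡⟨ cong₂ (λ k l → ℤtoℚ (binom (+ 0) k) * ℤtoℚ (+ l) * β M) (ℕP.n∸n≡0 M) [M+r]CM≡[M+r]Cr ⟩
  1ℚ * ℤtoℚ (+ ((M ℕ.+ r) C r)) * β M
    ≡⟨ cong (_* β M) (ℚP.*-identityˡ (ℤtoℚ (+ ((M ℕ.+ r) C r)))) ⟩
  ℤtoℚ (+ ((M ℕ.+ r) C r)) * β M ∎
  where
  open ≡-Reasoning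
  f : ℕ → ℚ
  f n = ℤtoℚ (binom (+ 0) (M ∸ n)) * ℤtoℚ (binom (+ (n ℕ.+ r)) n) * β n
  [M+r]CM≡[M+r]Cr : (M ℕ.+ r) C M ≡ (M ℕ.+ r) C r
  [M+r]CM≡[M+r]Cr = trans (nCk≡nC[n∸k] (ℕP.m≤m+n M r)) (cong ((M ℕ.+ r) C_) (ℕP.m+n∸m≡n M r))
  vanishing : ∀ n → n < M → f n ≡ 0ℚ
  vanishing n n<M = begin
    ℤtoℚ (binom (+ 0) (M ∸ n)) * b * β n          ≡⟨ cong (λ k → ℤtoℚ (binom (+ 0) k) * b * β n) (ℕP.+-∸-assoc 1 n<M) ⟩
    ℤtoℚ (binom (+ 0) (suc (M ∸ suc n))) * b * β n ≡⟨ cong (_* β n) (ℚP.*-zeroˡ b) ⟩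
    0ℚ * β n                                      ≡⟨ ℚP.*-zeroˡ (β n) ⟩
    0ℚ                                            ∎
    where b = ℤtoℚ (binom (+ (n ℕ.+ r)) n)

binomSum-at-top : ∀ β M r →
  binomSum β M r (+ (M ℕ.+ r)) ≡ ℤtoℚ (+ ((M ℕ.+ r) C r)) * sumℚ (suc M) (λ n → ℤtoℚ (+ (M C n)) * β n)
binomSum-at-top β M r =
  trans (sumℚ-cong (suc M) factor) (*-distribˡ-sumℚ (suc M) c (λ n → ℤtoℚ (+ (M C n)) * β n))
  where
  open ≡-Reasoning
  c = ℤtoℚ (+ ((M ℕ.+ r) C r))
  ℤtoℚ-*ℕ : ∀ p q → ℤtoℚ (+ (p ℕ.* q)) ≡ ℤtoℚ (+ p) * ℤtoℚ (+ q)
  ℤtoℚ-*ℕ p q = trans (cong ℤtoℚ (ℤP.pos-* p q)) (ℤtoℚ-homo-* (+ p) (+ q))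
  revision : ∀ {n} → n ≤ M → ((M ℕ.+ r) C (M ∸ n)) ℕ.* ((n ℕ.+ r) C n) ≡ ((M ℕ.+ r) C r) ℕ.* (M C n)
  revision {n} n≤M = subst (λ T → ((T ℕ.+ r) C (M ∸ n)) ℕ.* ((n ℕ.+ r) C n) ≡ ((T ℕ.+ r) C r) ℕ.* (T C n))
                           (ℕP.m∸n+n≡m n≤M) (trinomial-revision (M ∸ n) n r)
  factor : ∀ n → n < suc M →
    ℤtoℚ (+ ((M ℕ.+ r) C (M ∸ n))) * ℤtoℚ (+ ((n ℕ.+ r) C n)) * β n ≡ c * (ℤtoℚ (+ (M C n)) * β n)
  factor n (s≤s n≤M) = begin
    ℤtoℚ (+ ((M ℕ.+ r) C (M ∸ n))) * ℤtoℚ (+ ((n ℕ.+ r) C n)) * β n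
      ≡⟨ cong (_* β n) (ℤtoℚ-*ℕ ((M ℕ.+ r) C (M ∸ n)) ((n ℕ.+ r) C n)) ⟨
    ℤtoℚ (+ (((M ℕ.+ r) C (M ∸ n)) ℕ.* ((n ℕ.+ r) C n))) * β n
      ≡⟨ cong (λ k → ℤtoℚ (+ k) * β n) (revision n≤M) ⟩
    ℤtoℚ (+ (((M ℕ.+ r) C r) ℕ.* (M C n))) * β n
      ≡⟨ cong (_* β n) (ℤtoℚ-*ℕ ((M ℕ.+ r) C r) (M C n)) ⟩
    c * ℤtoℚ (+ (M C n)) * β n
      ≡⟨ ℚP.*-assoc c (ℤtoℚ (+ (M C n))) (β n) ⟩
    c * (ℤtoℚ (+ (M C n)) * β n) ∎

binomSum-top≡bottom : ∀ {β} → BernoulliRecurrence β → ∀ m r →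
  binomSum β (suc (suc m)) r (+ (suc (suc m) ℕ.+ r)) ≡ binomSum β (suc (suc m)) r (+ 0)
binomSum-top≡bottom {β} rec m r = begin
  binomSum β M r (+ (M ℕ.+ r))                                  ≡⟨ binomSum-at-top β M r ⟩
  c * (sumℚ M (λ n → ℤtoℚ (+ (M C n)) * β n) + ℤtoℚ (+ (M C M)) * β M)
                                                                ≡⟨ cong₂ (λ s k → c * (s + ℤtoℚ (+ k) * β M)) (rec m) (nCn≡1 M) ⟩
  c * (0ℚ + 1ℚ * β M)                                           ≡⟨ cong (c *_) (trans (ℚP.+-identityˡ (1ℚ * β M)) (ℚP.*-identityˡ (β M))) ⟩
  c * β M                                                       ≡⟨ binomSum-at-0 β M r ⟨
  binomSum β M r (+ 0)                                          ∎
  where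
  open ≡-Reasoning
  M = suc (suc m)
  c = ℤtoℚ (+ ((M ℕ.+ r) C r))

ReflectionSymmetry : (ℕ → ℚ) → ℕ → Set
ReflectionSymmetry β m = ∀ r x → binomSum β m r x ≡ signℚ m * binomSum β m r (+ (m ℕ.+ r) ℤ.- x)

module _ (β : ℕ → ℚ) (m r : ℕ) where

  private
    N = suc m ℕ.+ r
    Q = binomSum β (suc m) r

  reflectionDefect : ℤ → ℚ
  reflectionDefect x = Q x - signℚ (suc m) * Q (+ N ℤ.- x)

  reflectionDefect-suc : ReflectionSymmetry β m → ∀ x → reflectionDefect (ℤ.suc x) ≡ reflectionDefect x
  reflectionDefect-suc reflection x = begin
    Q (ℤ.suc x) - s * Q y
      ≡⟨ cong (_- s * Q y) (binomSum-pascal β m r x) ⟩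
    Q x + binomSum β m r x - s * Q y
      ≡⟨ cong (λ q → Q x + q - s * Q y) (reflection r x) ⟩
    Q x + signℚ m * binomSum β m r (+ (m ℕ.+ r) ℤ.- x) - s * Q y
      ≡⟨ cong (λ z → Q x + signℚ m * binomSum β m r z - s * Q y) m+r-x≡y ⟩
    Q x + signℚ m * binomSum β m r y - s * Q y
      ≡⟨ regroup (Q x) (binomSum β m r y) (Q y) (signℚ m) ⟩
    Q x - s * (Q y + binomSum β m r y)
      ≡⟨ cong (λ q → Q x - s * q) (binomSum-pascal β m r y) ⟨
    Q x - s * Q (ℤ.suc y)
      ≡⟨ cong (λ z → Q x - s * Q z) N-x≡1+y ⟨
    Q x - s * Q (+ N ℤ.- x) ∎
    where
    open ≡-Reasoning
    s = signℚ (suc m)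
    y = + N ℤ.- ℤ.suc x
    m+r-x≡y : + (m ℕ.+ r) ℤ.- x ≡ y
    m+r-x≡y = shift (+ (m ℕ.+ r)) x
      where
      shift : ∀ a x → a ℤ.- x ≡ (+ 1 ℤ.+ a) ℤ.- (+ 1 ℤ.+ x)
      shift = ℤ-Solver.solve-∀
    N-x≡1+y : + N ℤ.- x ≡ ℤ.suc y
    N-x≡1+y = shift (+ N) x
      where
      shift : ∀ a x → a ℤ.- x ≡ + 1 ℤ.+ (a ℤ.- (+ 1 ℤ.+ x))
      shift = ℤ-Solver.solve-∀
    regroup : ∀ a b c t → a + t * b - (- t) * c ≡ a - (- t) * (c + b)
    regroup = solve-∀ ℚ-ring

  reflectionDefect-sum : BernoulliRecurrence β → sumℚ (suc N) (λ k → reflectionDefect (+ k)) ≡ 0ℚ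
  reflectionDefect-sum rec = begin
    sumℚ (suc N) (λ k → reflectionDefect (+ k))
      ≡⟨ sumℚ-sub-* (suc N) s (λ k → Q (+ k)) (λ k → Q (+ N ℤ.- + k)) ⟩
    T - s * sumℚ (suc N) (λ k → Q (+ N ℤ.- + k))
      ≡⟨ cong (λ z → T - s * z) (trans (sumℚ-cong (suc N) N-k≡N∸k) (sumℚ-reverse N (λ k → Q (+ k)))) ⟩
    T - s * T
      ≡⟨ cong (λ z → z - s * z) T≡0 ⟩
    0ℚ - s * 0ℚ
      ≡⟨ 0-s*0≡0 s ⟩
    0ℚ ∎
    where
    open ≡-Reasoning
    s = signℚ (suc m)
    T = sumℚ (suc N) (λ k → Q (+ k))
    N-k≡N∸k : ∀ k → k < suc N → Q (+ N ℤ.- + k) ≡ Q (+ (N ∸ k))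
    N-k≡N∸k k (s≤s k≤N) = cong Q ([+m]-[+n]≡+[m∸n] k≤N)
    T≡0 : T ≡ 0ℚ
    T≡0 = begin
      T                                   ≡⟨ sumℚ-telescope (suc N) (λ k → binomSum β (suc (suc m)) r (+ k)) (λ k → Q (+ k))
                                                            (λ k → binomSum-pascal β (suc m) r (+ k)) ⟩
      binomSum β (suc (suc m)) r (+ suc N) - binomSum β (suc (suc m)) r (+ 0)
                                          ≡⟨ cong (_- binomSum β (suc (suc m)) r (+ 0)) (binomSum-top≡bottom rec m r) ⟩
      binomSum β (suc (suc m)) r (+ 0) - binomSum β (suc (suc m)) r (+ 0)
                                          ≡⟨ ℚP.+-inverseʳ (binomSum β (suc (suc m)) r (+ 0)) ⟩
      0ℚ                                  ∎
    0-s*0≡0 : ∀ s → 0ℚ - s * 0ℚ ≡ 0ℚ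
    0-s*0≡0 = solve-∀ ℚ-ring

  reflectionDefect≡0 : BernoulliRecurrence β → ReflectionSymmetry β m → ∀ x → reflectionDefect x ≡ 0ℚ
  reflectionDefect≡0 rec reflection x = trans (constant x) (ℤtoℚ[1+n]*p≡0⇒p≡0 N (reflectionDefect (+ 0)) (begin
    ℤtoℚ (+ suc N) * reflectionDefect (+ 0)         ≡⟨ sumℚ-const (suc N) (reflectionDefect (+ 0)) ⟨
    sumℚ (suc N) (λ _ → reflectionDefect (+ 0))    ≡⟨ sumℚ-cong (suc N) (λ k _ → constant (+ k)) ⟨
    sumℚ (suc N) (λ k → reflectionDefect (+ k))    ≡⟨ reflectionDefect-sum rec ⟩
    0ℚ                                             ∎))
    where
    open ≡-Reasoning
    constant = suc-invariant⇒constant reflectionDefect (reflectionDefect-suc reflection)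

binomSum-reflection : ∀ {β} → BernoulliRecurrence β → ∀ m → ReflectionSymmetry β m
binomSum-reflection {β} rec zero    r x = trans (binomSum[0]-constant β r x (+ r ℤ.- x)) (sym (ℚP.*-identityˡ _))
binomSum-reflection {β} rec (suc m) r x = begin
  Q x                                 ≡⟨ split (Q x) (s * Q (+ N ℤ.- x)) ⟩
  reflectionDefect β m r x + s * Q (+ N ℤ.- x)
                                      ≡⟨ cong (_+ s * Q (+ N ℤ.- x)) (reflectionDefect≡0 β m r rec (binomSum-reflection rec m) x) ⟩
  0ℚ + s * Q (+ N ℤ.- x)              ≡⟨ ℚP.+-identityˡ (s * Q (+ N ℤ.- x)) ⟩
  s * Q (+ N ℤ.- x)                   ∎
  where
  open ≡-Reasoning
  N = suc m ℕ.+ r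
  Q = binomSum β (suc m) r
  s = signℚ (suc m)
  split : ∀ a b → a ≡ a - b + b
  split = solve-∀ ℚ-ring

binomSum-antireflection : ∀ {β} → BernoulliRecurrence β → ∀ {m} → signℚ m ≡ - 1ℚ → ∀ r x →
  - binomSum β m r x ≡ binomSum β m r (+ (m ℕ.+ r) ℤ.- x)
binomSum-antireflection {β} rec {m} signℚ[m]≡-1 r x = begin
  - binomSum β m r x                 ≡⟨ cong -_ (binomSum-reflection rec m r x) ⟩
  - (signℚ m * binomSum β m r y)     ≡⟨ cong (λ z → - (z * binomSum β m r y)) signℚ[m]≡-1 ⟩
  - (- 1ℚ * binomSum β m r y)        ≡⟨ neg-neg (binomSum β m r y) ⟩
  binomSum β m r y                   ∎
  where
  open ≡-Reasoning
  y = + (m ℕ.+ r) ℤ.- x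
  neg-neg : ∀ q → - (- 1ℚ * q) ≡ q
  neg-neg = solve-∀ ℚ-ring

signℚ[2K+1∸2s]≡-1 : ∀ {K s} → s ≤ K → signℚ (2 ℕ.* K ℕ.+ 1 ∸ 2 ℕ.* s) ≡ - 1ℚ
signℚ[2K+1∸2s]≡-1 {K} {s} s≤K = begin
  signℚ (2 ℕ.* K ℕ.+ 1 ∸ 2 ℕ.* s)             ≡⟨ cong (λ z → signℚ (2 ℕ.* z ℕ.+ 1 ∸ 2 ℕ.* s)) (ℕP.m+[n∸m]≡n s≤K) ⟨
  signℚ (2 ℕ.* (s ℕ.+ t) ℕ.+ 1 ∸ 2 ℕ.* s)     ≡⟨ cong (λ z → signℚ (z ∸ 2 ℕ.* s)) (expand s t) ⟩
  signℚ (2 ℕ.* s ℕ.+ suc (t ℕ.+ t) ∸ 2 ℕ.* s) ≡⟨ cong signℚ (ℕP.m+n∸m≡n (2 ℕ.* s) (suc (t ℕ.+ t))) ⟩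
  - signℚ (t ℕ.+ t)                           ≡⟨ cong -_ (signℚ-even t) ⟩
  - 1ℚ                                        ∎
  where
  open ≡-Reasoning
  t = K ∸ s
  expand : ∀ s t → 2 ℕ.* (s ℕ.+ t) ℕ.+ 1 ≡ 2 ℕ.* s ℕ.+ suc (t ℕ.+ t)
  expand = ℕ-Solver.solve-∀

m∸o≡[m∸n]+[n∸o] : ∀ {m n o} → o ≤ n → n ≤ m → m ∸ o ≡ (m ∸ n) ℕ.+ (n ∸ o)
m∸o≡[m∸n]+[n∸o] {m} {n} {o} o≤n n≤m = trans (cong (_∸ o) (sym (ℕP.m∸n+n≡m n≤m))) (ℕP.+-∸-assoc (m ∸ n) o≤n)

corollary3 : (K : ℕ) → 2 ≤ K → (s : ℕ) → 1 ≤ s → s ≤ K → (i : ℤ) →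
    let k = 2 ℕ.* K ℕ.+ 1 in
    - sumℚ (suc (k ∸ 2 ℕ.* s))
        (λ n → ℤtoℚ (binom i ((k ∸ 2 ℕ.* s) ∸ n)) *
               ℤtoℚ (binom (+ (n ℕ.+ 2 ℕ.* s ∸ 2)) n) * B n)
      ≡ sumℚ (suc (k ∸ 2 ℕ.* s))
        (λ n → ℤtoℚ (binom (+ k ℤ.- + 2 ℤ.- i) ((k ∸ 2 ℕ.* s) ∸ n)) *
               ℤtoℚ (binom (+ (n ℕ.+ 2 ℕ.* s ∸ 2)) n) * B n)
corollary3 K _ s 1≤s s≤K i = begin
  - S i                                ≡⟨ cong -_ (S≡binomSum i) ⟩
  - binomSum B m r i                   ≡⟨ binomSum-antireflection B-recurrence {m} (signℚ[2K+1∸2s]≡-1 s≤K) r i ⟩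
  binomSum B m r (+ (m ℕ.+ r) ℤ.- i)   ≡⟨ cong (λ z → binomSum B m r (z ℤ.- i)) k-2≡m+r ⟨
  binomSum B m r (+ k ℤ.- + 2 ℤ.- i)   ≡⟨ S≡binomSum (+ k ℤ.- + 2 ℤ.- i) ⟨
  S (+ k ℤ.- + 2 ℤ.- i)                ∎
  where
  open ≡-Reasoning
  k = 2 ℕ.* K ℕ.+ 1
  m = k ∸ 2 ℕ.* s
  r = 2 ℕ.* s ∸ 2
  2≤2s : 2 ≤ 2 ℕ.* s
  2≤2s = ℕP.*-monoʳ-≤ 2 1≤s
  2s≤k : 2 ℕ.* s ≤ k
  2s≤k = ℕP.≤-trans (ℕP.*-monoʳ-≤ 2 s≤K) (ℕP.m≤m+n (2 ℕ.* K) 1)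
  k-2≡m+r : + k ℤ.- + 2 ≡ + (m ℕ.+ r)
  k-2≡m+r = trans ([+m]-[+n]≡+[m∸n] (ℕP.≤-trans 2≤2s 2s≤k)) (cong +_ (m∸o≡[m∸n]+[n∸o] 2≤2s 2s≤k))
  S : ℤ → ℚ
  S x = sumℚ (suc m) (λ n → ℤtoℚ (binom x (m ∸ n)) * ℤtoℚ (binom (+ (n ℕ.+ 2 ℕ.* s ∸ 2)) n) * B n)
  S≡binomSum : ∀ x → S x ≡ binomSum B m r x
  S≡binomSum x = sumℚ-cong (suc m) λ n _ →
    cong (λ a → ℤtoℚ (binom x (m ∸ n)) * ℤtoℚ (binom (+ a) n) * B n) (ℕP.+-∸-assoc n 2≤2s)
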